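{- Let $d \geq 1$ and let $A$ be a subset of $\mathbf{N}_0^d$, the additive semigroup of $d$-dimensional lattice points with nonnegative integer coordinates. Let $(A_q)_{q=1}^{\infty}$ be a decreasing sequence of subsets of $\mathbf{N}_0^d$ (i.e. $A_q \supseteq A_{q+1}$ for all $q$) such that $A = \bigcap_{q=1}^{\infty} A_q$. Then for every positive integer $h$, \[ hA = \bigcap_{q=1}^{\infty} hA_q. \]
   Context: For a subset $A$ of an additive abelian semigroup and a positive integer $h$, $hA = \{a_1+\cdots+a_h : a_i \in A \text{ for all } i\}$ denotes the $h$-fold sumset. -}

module Defs where

open import Level using (0ℓ)
open import Data.Nat using (ℕ; zero; suc; _+_)
open import Data.Fin using (Fin; zero; suc)
open import Data.Vec using (Vec; replicate; zipWith)
open import Data.Product using (Σ; _×_)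
open import Relation.Unary using (Pred; _∈_)
open import Relation.Binary.PropositionalEquality using (_≡_)

Point : ℕ → Set
Point d = Vec ℕ d

_⊕_ : ∀ {d} → Point d → Point d → Point d
_⊕_ = zipWith _+_

𝟎 : ∀ {d} → Point d
𝟎 = replicate _ 0

sumPts : ∀ {d} (h : ℕ) → (Fin h → Point d) → Point d
sumPts zero    a = 𝟎
sumPts (suc h) a = a zero ⊕ sumPts h (λ i → a (suc i))

Subset : ℕ → Set₁
Subset d = Pred (Point d) 0ℓ

sumset : ∀ {d} → ℕ → Subset d → Subset d
sumset {d} h A x = Σ (Fin h → Point d) (λ a → ((i : Fin h) → a i ∈ A) × sumPts h a ≡ x)

{-# OPTIONS --safe #-}
-- If x lies in every hA_q, then for each q some y lies in A_q with x - y in (h-1)A_q.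
-- Such a y lies in the finite box below x, and since the A_q decrease, the q for which a
-- given y works form an initial segment of ℕ.  Classically, some y therefore works for
-- all q (were each to fail from some q on, none would work beyond the largest of these).
-- As x - y is then independent of q, induction on h finishes the proof.
module Submission where

open import Defs
open import Data.Nat using (ℕ; zero; suc; _+_; _≤_; s≤s; _≤′_; ≤′-refl; ≤′-step)
open import Level using (0ℓ)
open import Axiom.ExcludedMiddle using (ExcludedMiddle)
open import Relation.Unary using (Pred; _∈_; _⊆_; ⋂)
open import Function.Bundles using (_⇔_; mk⇔)
open import Axiom.DoubleNegationElimination using (em⇒dne)
open import Data.Nat.Properties using (≤⇒≤′; m≤m+n; m≤n+m; +-cancelˡ-≡)
open import Data.Fin using (zero; suc)
open import Data.Vec using ([]; _∷_)
open import Data.Vec.Properties using (∷-injective)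
import Data.Vec.Functional as Vector
open import Data.List using (List; []; _∷_; [_]; upTo; cartesianProductWith)
open import Data.List.Relation.Unary.Any using (Any; here; tail)
open import Data.List.Membership.Propositional using (lose) renaming (_∈_ to _∈ₗ_)
open import Data.List.Membership.Propositional.Properties
  using (∈-upTo⁺; ∈-cartesianProductWith⁺)
open import Data.Product using (∃; _×_; _,_; proj₁)
open import Function using (_∘_; case_of_)
open import Relation.Nullary using (¬_; yes; no)
open import Relation.Nullary.Negation using (¬∃⟶∀¬)
open import Relation.Binary.PropositionalEquality using (_≡_; refl; cong₂; sym; trans; subst)
open Function.Bundles.Equivalence using (to; from)

Decreasing : ∀ {a ℓ} {X : Set a} → (ℕ → Pred X ℓ) → Set _
Decreasing P = ∀ q → P (suc q) ⊆ P q

module _ {a ℓ} {X : Set a} {P : ℕ → Pred X ℓ} (decreasing : Decreasing P) where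

  decreasing-≤ : ∀ {m n} → m ≤ n → P n ⊆ P m
  decreasing-≤ = go ∘ ≤⇒≤′
    where
    go : ∀ {m n} → m ≤′ n → P n ⊆ P m
    go ≤′-refl        = λ p → p
    go (≤′-step m≤′n) = go m≤′n ∘ decreasing _

module _ {ℓ} (em : ExcludedMiddle ℓ) where

  ¬∀⇒∃¬ : {Q : ℕ → Set ℓ} → ¬ (∀ q → Q q) → ∃ λ q → ¬ Q q
  ¬∀⇒∃¬ ¬∀ = dne λ ¬∃ → ¬∀ λ q → dne (¬∃⟶∀¬ ¬∃ q)
    where dne = em⇒dne em

  -- If the head x fails at q₀, then from q₀ on some element of the tail works:
  -- recurse on the tail with the sequence shifted by q₀.
  decreasing-Any⇒∃∀ : ∀ {a} {X : Set a} {P : ℕ → Pred X ℓ} → Decreasing P →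
                      (xs : List X) → (∀ q → Any (P q) xs) → ∃ λ x → ∀ q → P q x
  decreasing-Any⇒∃∀ _ [] any = case any 0 of λ ()
  decreasing-Any⇒∃∀ {P = P} decreasing (x ∷ xs) any with em {∀ q → P q x}
  ... | yes ∀Px = x , ∀Px
  ... | no ¬∀Px =
    let q₀ , ¬Pq₀x = ¬∀⇒∃¬ ¬∀Px
        y , ∀Py = decreasing-Any⇒∃∀ (λ q → decreasing (q + q₀)) xs
                    (λ q → tail (¬Pq₀x ∘ decreasing-≤ decreasing (m≤n+m q₀ q)) (any (q + q₀)))
    in y , λ q → decreasing-≤ decreasing (m≤m+n q q₀) (∀Py q)

⊕-cancelˡ : ∀ {d} (x : Point d) {y z : Point d} → x ⊕ y ≡ x ⊕ z → y ≡ z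
⊕-cancelˡ []      {[]}    {[]}    _  = refl
⊕-cancelˡ (m ∷ x) {n ∷ y} {k ∷ z} eq =
  let m+n≡m+k , x⊕y≡x⊕z = ∷-injective eq
  in cong₂ _∷_ (+-cancelˡ-≡ m n k m+n≡m+k) (⊕-cancelˡ x x⊕y≡x⊕z)

summands : ∀ {d} → Point d → List (Point d)
summands []      = [ [] ]
summands (n ∷ x) = cartesianProductWith _∷_ (upTo (suc n)) (summands x)

∈-summands : ∀ {d} (y z : Point d) → y ∈ₗ summands (y ⊕ z)
∈-summands []      []      = here refl
∈-summands (m ∷ y) (n ∷ z) =
  ∈-cartesianProductWith⁺ _∷_ (∈-upTo⁺ (s≤s (m≤m+n m n))) (∈-summands y z)

module _ {d : ℕ} where

  sumset-mono : ∀ h {A B : Subset d} → A ⊆ B → sumset h A ⊆ sumset h B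
  sumset-mono h A⊆B (a , a∈A , Σa≡x) = a , A⊆B ∘ a∈A , Σa≡x

  FirstSummand : ℕ → Subset d → Point d → Subset d
  FirstSummand h A x y = y ∈ A × ∃ λ z → z ∈ sumset h A × y ⊕ z ≡ x

  firstSummand-mono : ∀ h {A B : Subset d} {x} → A ⊆ B → FirstSummand h A x ⊆ FirstSummand h B x
  firstSummand-mono h {A} {B} A⊆B (y∈A , z , z∈hA , y⊕z≡x) =
    A⊆B y∈A , z , sumset-mono h {A} {B} A⊆B {z} z∈hA , y⊕z≡x

  sumset-suc⁻ : ∀ {h A x} → x ∈ sumset (suc h) A → ∃ (FirstSummand h A x)
  sumset-suc⁻ {h} (a , a∈A , Σa≡x) =
    a zero , a∈A zero , sumPts h (Vector.tail a) , (Vector.tail a , a∈A ∘ suc , refl) , Σa≡x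

  sumset-suc⁺ : ∀ {h A x y} → y ∈ FirstSummand h A x → x ∈ sumset (suc h) A
  sumset-suc⁺ {A = A} {y = y} (y∈A , z , (b , b∈A , refl) , refl) = y Vector.∷ b , all∈A , refl
    where
    all∈A : ∀ i → (y Vector.∷ b) i ∈ A
    all∈A zero    = y∈A
    all∈A (suc i) = b∈A i

  firstSummand∈summands : ∀ {h A x y} → y ∈ FirstSummand h A x → y ∈ₗ summands x
  firstSummand∈summands {y = y} (_ , z , _ , refl) = ∈-summands y z

  module _ {Aq : ℕ → Subset d} (decreasing : Decreasing Aq) where

    -- The complement x - y of a first summand does not depend on q, by cancellation.
    firstSummand-⋂ : ∀ {h x y} → ⋂ ℕ (sumset h ∘ Aq) ⊆ sumset h (⋂ ℕ Aq) →
                     (∀ q → y ∈ FirstSummand h (Aq q) x) → y ∈ FirstSummand h (⋂ ℕ Aq) x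
    firstSummand-⋂ {h} {y = y} ⋂⊆ y-first with _ , z , _ , y⊕z≡x ← y-first 0 =
      proj₁ ∘ y-first , z , ⋂⊆ z∈ , y⊕z≡x
      where
      z∈ : ∀ q → z ∈ sumset h (Aq q)
      z∈ q with _ , z′ , z′∈ , y⊕z′≡x ← y-first q =
        subst (sumset h (Aq q)) (⊕-cancelˡ y (trans y⊕z′≡x (sym y⊕z≡x))) z′∈

    sumset-⋂ : ExcludedMiddle 0ℓ → ∀ h → ⋂ ℕ (sumset h ∘ Aq) ⊆ sumset h (⋂ ℕ Aq)
    sumset-⋂ _  zero    x∈ = case x∈ 0 of λ (a , _ , Σa≡x) → a , (λ ()) , Σa≡x
    sumset-⋂ em (suc h) {x} x∈ =
      let y , y-first = decreasing-Any⇒∃∀ em (λ q → firstSummand-mono h (decreasing q))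
                          (summands x) some-first
      in sumset-suc⁺ {A = ⋂ ℕ Aq} (firstSummand-⋂ {h} {x} {y} (sumset-⋂ em h) y-first)
      where
      some-first : ∀ q → Any (FirstSummand h (Aq q) x) (summands x)
      some-first q = let _ , y-first = sumset-suc⁻ {A = Aq q} (x∈ q)
                     in lose (firstSummand∈summands {h} {Aq q} y-first) y-first

mainTheorem2 : ExcludedMiddle 0ℓ →
    (d : ℕ) → 1 ≤ d →
    (A : Subset d) → (Aq : ℕ → Subset d) →
    (∀ q → Aq (suc q) ⊆ Aq q) →
    (∀ x → (x ∈ A) ⇔ (∀ q → x ∈ Aq q)) →
    (h : ℕ) → 1 ≤ h →
    ∀ x → (x ∈ sumset h A) ⇔ (∀ q → x ∈ sumset h (Aq q))
mainTheorem2 em d _ A Aq decreasing A≐⋂Aq h _ x =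
  mk⇔ (λ x∈hA q → sumset-mono h {A} {Aq q} (λ a∈A → A⊆⋂Aq a∈A q) {x} x∈hA)
      (sumset-mono h {⋂ ℕ Aq} {A} ⋂Aq⊆A {x} ∘ sumset-⋂ decreasing em h)
  where
  A⊆⋂Aq : A ⊆ ⋂ ℕ Aq
  A⊆⋂Aq {a} = to (A≐⋂Aq a)
  ⋂Aq⊆A : ⋂ ℕ Aq ⊆ A
  ⋂Aq⊆A {a} = from (A≐⋂Aq a)
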